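{- Let $n\ge 1$ and let $w\in B_n$ be written as $w=\beta\prod_{k=1}^n t_k^{r_k}$ with $\beta\in S_n$ and $r_k\in\{0,1\}$, so that $w(k)=(-1)^{r_k}\beta_k$ where $\beta_k=\beta(k)$. Then for every $i=1,\dots,n$, writing $p=n+1-i$, \[ inv_i(w)=r_{p}+2\,\bigl|\{\,j : 1\le j<p,\ \beta_j<\beta_{p},\ r_{p}\neq 0\,\}\bigr|+inv_i(\beta), \] where $inv_i(\beta)=\bigl|\{\,j: 1\le j<p,\ \beta_j>\beta_p\,\}\bigr|$. In particular, $inv_i(w)=1+2\,|\{j<p:\beta_j<\beta_p\}|+inv_i(\beta)$ if $r_p=1$, and $inv_i(w)=inv_i(\beta)$ if $r_p=0$.
   Context: Let $e_1,\dots,e_n$ be the standard basis of $\mathbb{R}^n$. The hyperoctahedral group $B_n$ is the group of signed permutations: linear maps $w$ of $\mathbb{R}^n$ with $w(e_k)=(-1)^{r_k}e_{\beta(k)}$ for some $\beta\in S_n$ and $r_k\in\{0,1\}$; equivalently $w=\beta\prod_{k=1}^n t_k^{r_k}$, where $t_k$ is the reflection negating $e_k$ and $\beta$ acts by permuting basis vectors, $\beta(e_k)=e_{\beta(k)}$. We write $w(k)=(-1)^{r_k}\beta(k)$. The positive roots are $\Psi^+=\{e_l:1\le l\le n\}\cup\{e_j-e_i,\ e_j+e_i: 1\le i<j\le n\}$ and $\Psi^-=-\Psi^+$. For $i=1,\dots,n$ put $\Psi_i=\{e_{n+1-i}\}\cup\{e_{n+1-i}-e_j,\ e_{n+1-i}+e_j: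 1\le j<n+1-i\}$ and define $inv_i(w)=|w(\Psi_i)\cap\Psi^-|$. -}

module Defs where

open import Data.Nat using (ℕ)
open import Data.Integer using (ℤ; +_; -_; _+_; _-_; _≟_)
open import Data.Fin using (Fin; toℕ; opposite; _<?_; _<_; _>_)
open import Data.Fin.Permutation using (Permutation′; _⟨$⟩ʳ_; _⟨$⟩ˡ_)
open import Data.Vec using (Vec; tabulate; zipWith; map)
open import Data.Vec.Properties using (≡-dec)
open import Data.List using (List; []; _∷_; _++_; concatMap; filter; length; allFin)
import Data.List.Membership.DecPropositional as DecMem
open import Relation.Nullary using (does; ¬_)
open import Relation.Nullary.Decidable using (¬?)
open import Data.Bool using (if_then_else_)
import Data.Fin as F

-- Vectors of ℝⁿ restricted to integer coordinates (roots of Bₙ are integral);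
-- coordinates are 0-indexed: coordinate k : Fin n is the paper's k+1.
Vecⁿ : ℕ → Set
Vecⁿ n = Vec ℤ n

_⊕_ _⊖_ : ∀ {n} → Vecⁿ n → Vecⁿ n → Vecⁿ n
u ⊕ v = zipWith _+_ u v
u ⊖ v = zipWith _-_ u v

neg : ∀ {n} → Vecⁿ n → Vecⁿ n
neg = map (λ x → - x)

e : ∀ {n} → Fin n → Vecⁿ n
e k = tabulate (λ m → if does (m F.≟ k) then + 1 else + 0)

record Bn (n : ℕ) : Set where
  constructor signedPerm
  field
    β : Permutation′ n
    r : Fin n → Fin 2
open Bn public

sgn : Fin 2 → ℤ → ℤ
sgn F.zero    x = x
sgn (F.suc _) x = - x

-- linear action: w(e_k) = (-1)^{r_k} e_{β(k)}, i.e.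
-- (w v)_m = (-1)^{r_{β⁻¹ m}} v_{β⁻¹ m}
act : ∀ {n} → Bn n → Vecⁿ n → Vecⁿ n
act w v = tabulate (λ m → sgn (r w (β w ⟨$⟩ˡ m)) (Data.Vec.lookup v (β w ⟨$⟩ˡ m)))

Ψ⁺ : (n : ℕ) → List (Vecⁿ n)
Ψ⁺ n = concatMap (λ (l : Fin n) → e l ∷ []) (allFin n)
    ++ concatMap (λ (i : Fin n) → concatMap (λ (j : Fin n) → e j ⊖ e i ∷ e j ⊕ e i ∷ [])
                                  (filter (λ j → i <? j) (allFin n)))
                 (allFin n)

Ψ⁻ : (n : ℕ) → List (Vecⁿ n)
Ψ⁻ n = Data.List.map neg (Ψ⁺ n)

-- Ψ_i for the paper's index i = toℕ i + 1; the paper's n+1-i is the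
-- 0-indexed coordinate  opposite i  (toℕ (opposite i) = n - 1 - toℕ i).
Ψ : ∀ {n} → Fin n → List (Vecⁿ n)
Ψ {n} i = e p ∷ concatMap (λ j → e p ⊖ e j ∷ e p ⊕ e j ∷ [])
                          (filter (λ j → j <? p) (allFin n))
  where
  p : Fin n
  p = opposite i


-- inv_i(w) = |w(Ψ_i) ∩ Ψ⁻|  (Ψ_i consists of distinct vectors, and w is injective)
inv : ∀ {n} → Bn n → Fin n → ℕ
inv {n} w i = length (filter (λ v → act w v ∈? Ψ⁻ n) (Ψ i))
  where open DecMem (≡-dec {n = n} _≟_) using (_∈?_)

countLessNonzero : ∀ {n} → Bn n → Fin n → ℕ
countLessNonzero {n} w p =
  length (filter (λ j → j <? p) (filter (λ j → (β w ⟨$⟩ʳ j) <? (β w ⟨$⟩ʳ p))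
    (filter (λ j → ¬? (r w p F.≟ F.zero)) (allFin n))))

countLess : ∀ {n} → Permutation′ n → Fin n → ℕ
countLess {n} β p =
  length (filter (λ j → j <? p) (filter (λ j → (β ⟨$⟩ʳ j) <? (β ⟨$⟩ʳ p)) (allFin n)))

invPerm : ∀ {n} → Permutation′ n → Fin n → ℕ
invPerm {n} β i =
  length (filter (λ j → j <? p) (filter (λ j → (β ⟨$⟩ʳ p) <? (β ⟨$⟩ʳ j)) (allFin n)))
  where
  p : Fin n
  p = opposite i

{-# OPTIONS --safe #-}
-- Under w, e_p goes to ±e_{β p} and e_p ± e_j to ±e_{β p} ± e_{β j}.  Every positive
-- root has last nonzero entry +1, so a vector of this shape is a negative root exactly
-- when its entry of larger index is -1.  Hence e_p contributes r_p, and the pair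
-- e_p - e_j, e_p + e_j (j < p) contributes 2 r_p if β_j < β_p, and exactly 1 if
-- β_j > β_p, since the two images carry opposite signs at β_j.
module Submission where

open import Defs
open import Data.Nat using (ℕ; suc; _+_; _*_)
open import Data.Fin using (Fin; toℕ; opposite)
import Data.Fin as F
open import Data.Product using (_×_; _,_)
open import Relation.Binary.PropositionalEquality using (_≡_; _≢_; refl; sym; trans; cong; cong₂; subst; module ≡-Reasoning)

open import Data.Bool using (true; false; if_then_else_)
open import Data.Fin.Permutation using (Permutation′; _⟨$⟩ʳ_; _⟨$⟩ˡ_; inverseˡ; inverseʳ)
import Data.Fin.Properties as FinP
open import Data.Integer using (ℤ; +_; -[1+_]; -_; _-_) renaming (_+_ to _+ℤ_; _≟_ to _≟ℤ_)
import Data.Integer.Properties as ℤP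
open import Data.List using (List; []; _∷_; length; filter; allFin; concatMap)
open import Data.List.Membership.Propositional using (_∈_; _∉_)
open import Data.List.Membership.Propositional.Properties using (∈-map⁺; ∈-++⁺ˡ; ∈-++⁺ʳ; ∈-concatMap⁺; ∈-filter⁺; ∈-allFin)
import Data.List.Membership.DecPropositional as DecMembership
open import Data.List.Properties using (filter-accept; filter-reject)
open import Data.List.Relation.Unary.All as All using (All; []; _∷_)
open import Data.List.Relation.Unary.All.Properties using (++⁺; concat⁺; map⁺; tabulate⁺; all-filter)
open import Data.List.Relation.Unary.Any as Any using (here; there)
import Data.Nat.Properties as ℕP
open import Data.Nat.Tactic.RingSolver using (solve-∀)
open import Data.Vec using (Vec; []; _∷_; lookup; zipWith)
open import Data.Vec.Properties using (lookup∘tabulate; tabulate∘lookup; tabulate-cong; lookup-map; lookup-zipWith; zipWith-comm; ≡-dec)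
open import Function using (_∘_)
open import Relation.Binary.Definitions using (tri<; tri≈; tri>)
open import Relation.Nullary using (Dec; does; yes; no; ¬_)
open import Relation.Nullary.Decidable using (¬?; dec-true; dec-false)
open import Relation.Unary using (Pred; Decidable)

private variable
  n : ℕ

lookup-ext : ∀ {A : Set} {u v : Vec A n} → (∀ m → lookup u m ≡ lookup v m) → u ≡ v
lookup-ext {u = u} {v} eq = trans (sym (tabulate∘lookup u)) (trans (tabulate-cong eq) (tabulate∘lookup v))

lookup-ext-permuted : ∀ {A : Set} (π : Permutation′ n) {u v : Vec A n} →
  (∀ k → lookup u (π ⟨$⟩ʳ k) ≡ lookup v (π ⟨$⟩ʳ k)) → u ≡ v
lookup-ext-permuted π {u} {v} eq = lookup-ext λ m →
  subst (λ m′ → lookup u m′ ≡ lookup v m′) (inverseʳ π) (eq (π ⟨$⟩ˡ m))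

permutation-injective : (π : Permutation′ n) {x y : Fin n} → π ⟨$⟩ʳ x ≡ π ⟨$⟩ʳ y → x ≡ y
permutation-injective π eq = trans (sym (inverseˡ π)) (trans (cong (π ⟨$⟩ˡ_) eq) (inverseˡ π))

filter-comm : ∀ {a p q} {A : Set a} {P : Pred A p} {Q : Pred A q} (P? : Decidable P) (Q? : Decidable Q) xs →
  filter P? (filter Q? xs) ≡ filter Q? (filter P? xs)
filter-comm P? Q? []       = refl
filter-comm P? Q? (x ∷ xs) with does (P? x) in px | does (Q? x) in qx
... | false | false                 = filter-comm P? Q? xs
... | false | true  rewrite px      = filter-comm P? Q? xs
... | true  | false rewrite qx      = filter-comm P? Q? xs
... | true  | true  rewrite px | qx = cong (x ∷_) (filter-comm P? Q? xs)

length-filter-nonzero : ∀ {a} {A : Set a} (s : Fin 2) (xs : List A) →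
  length (filter (λ _ → ¬? (s F.≟ F.zero)) xs) ≡ toℕ s * length xs
length-filter-nonzero F.zero         []       = refl
length-filter-nonzero F.zero         (x ∷ xs) = length-filter-nonzero F.zero xs
length-filter-nonzero (F.suc F.zero) []       = refl
length-filter-nonzero (F.suc F.zero) (x ∷ xs) = cong suc (length-filter-nonzero (F.suc F.zero) xs)

indicator : ∀ {a} {A : Set a} → Dec A → ℕ
indicator a? = if does a? then 1 else 0

indicator-yes : ∀ {a} {A : Set a} (a? : Dec A) → A → indicator a? ≡ 1
indicator-yes a? x = cong (λ b → if b then 1 else 0) (dec-true a? x)

indicator-no : ∀ {a} {A : Set a} (a? : Dec A) → ¬ A → indicator a? ≡ 0
indicator-no a? ¬x = cong (λ b → if b then 1 else 0) (dec-false a? ¬x)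

length-filter-∷ : ∀ {a p} {A : Set a} {P : Pred A p} (P? : Decidable P) x xs →
  length (filter P? (x ∷ xs)) ≡ indicator (P? x) + length (filter P? xs)
length-filter-∷ P? x xs with does (P? x)
... | true  = refl
... | false = refl

sgn-zero : ∀ s → sgn s (+ 0) ≡ + 0
sgn-zero F.zero    = refl
sgn-zero (F.suc _) = refl

sgn-distrib-+ : ∀ s x y → sgn s (x +ℤ y) ≡ sgn s x +ℤ sgn s y
sgn-distrib-+ F.zero    x y = refl
sgn-distrib-+ (F.suc _) x y = ℤP.neg-distrib-+ x y

sgn-distrib-minus : ∀ s x y → sgn s (x - y) ≡ sgn s x - sgn s y
sgn-distrib-minus F.zero    x y = refl
sgn-distrib-minus (F.suc _) x y = ℤP.neg-distrib-+ x (- y)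

signed : Fin 2 → Vecⁿ n → Vecⁿ n
signed F.zero    v = v
signed (F.suc _) v = neg v

lookup-signed : ∀ s (v : Vecⁿ n) m → lookup (signed s v) m ≡ sgn s (lookup v m)
lookup-signed F.zero    v m = refl
lookup-signed (F.suc _) v m = lookup-map m -_ v

neg-⊕ : (u v : Vecⁿ n) → neg (u ⊕ v) ≡ neg u ⊕ neg v
neg-⊕ []      []      = refl
neg-⊕ (x ∷ u) (y ∷ v) = cong₂ _∷_ (ℤP.neg-distrib-+ x y) (neg-⊕ u v)

neg-⊖ : (u v : Vecⁿ n) → neg (u ⊖ v) ≡ neg u ⊕ v
neg-⊖ []      []      = refl
neg-⊖ (x ∷ u) (y ∷ v) =
  cong₂ _∷_ (trans (ℤP.neg-distrib-+ x (- y)) (cong (- x +ℤ_) (ℤP.neg-involutive y))) (neg-⊖ u v)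

-- On Fin 2, opposite swaps the two signs.
⊖-signed : ∀ s (u v : Vecⁿ n) → u ⊖ signed s v ≡ u ⊕ signed (opposite s) v
⊖-signed F.zero         []      []      = refl
⊖-signed F.zero         (x ∷ u) (y ∷ v) = cong (x - y ∷_) (⊖-signed F.zero u v)
⊖-signed (F.suc F.zero) []      []      = refl
⊖-signed (F.suc F.zero) (x ∷ u) (y ∷ v) =
  cong₂ _∷_ (cong (x +ℤ_) (ℤP.neg-involutive y)) (⊖-signed (F.suc F.zero) u v)

⊕-comm : (u v : Vecⁿ n) → u ⊕ v ≡ v ⊕ u
⊕-comm = zipWith-comm ℤP.+-comm

lookup-e-self : (a : Fin n) → lookup (e a) a ≡ + 1
lookup-e-self a = trans (lookup∘tabulate _ a) (cong (λ b → if b then + 1 else + 0) (dec-true (a F.≟ a) refl))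

lookup-e-≢ : {a m : Fin n} → m ≢ a → lookup (e a) m ≡ + 0
lookup-e-≢ {a = a} {m} m≢a =
  trans (lookup∘tabulate _ m) (cong (λ b → if b then + 1 else + 0) (dec-false (m F.≟ a) m≢a))

lookup-signed-e-≢ : ∀ s {a m : Fin n} → m ≢ a → lookup (signed s (e a)) m ≡ + 0
lookup-signed-e-≢ s {a} {m} m≢a =
  trans (lookup-signed s (e a) m) (trans (cong (sgn s) (lookup-e-≢ m≢a)) (sgn-zero s))

module _ (w : Bn n) where

  lookup-act : ∀ (v : Vecⁿ n) k → lookup (act w v) (β w ⟨$⟩ʳ k) ≡ sgn (r w k) (lookup v k)
  lookup-act v k = trans (lookup∘tabulate _ (β w ⟨$⟩ʳ k))
                         (cong (λ j → sgn (r w j) (lookup v j)) (inverseˡ (β w)))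

  act-zipWith : ∀ (_∙_ : ℤ → ℤ → ℤ) → (∀ s x y → sgn s (x ∙ y) ≡ sgn s x ∙ sgn s y) →
    ∀ (u v : Vecⁿ n) → act w (zipWith _∙_ u v) ≡ zipWith _∙_ (act w u) (act w v)
  act-zipWith _∙_ sgn-distrib u v = lookup-ext-permuted (β w) λ k → begin
    lookup (act w (zipWith _∙_ u v)) (β w ⟨$⟩ʳ k)      ≡⟨ lookup-act (zipWith _∙_ u v) k ⟩
    sgn (r w k) (lookup (zipWith _∙_ u v) k)           ≡⟨ cong (sgn (r w k)) (lookup-zipWith _∙_ k u v) ⟩
    sgn (r w k) (lookup u k ∙ lookup v k)              ≡⟨ sgn-distrib (r w k) _ _ ⟩
    sgn (r w k) (lookup u k) ∙ sgn (r w k) (lookup v k)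
      ≡⟨ sym (cong₂ _∙_ (lookup-act u k) (lookup-act v k)) ⟩
    lookup (act w u) (β w ⟨$⟩ʳ k) ∙ lookup (act w v) (β w ⟨$⟩ʳ k)
      ≡⟨ sym (lookup-zipWith _∙_ (β w ⟨$⟩ʳ k) (act w u) (act w v)) ⟩
    lookup (zipWith _∙_ (act w u) (act w v)) (β w ⟨$⟩ʳ k) ∎
    where open ≡-Reasoning

  act-e : ∀ k → act w (e k) ≡ signed (r w k) (e (β w ⟨$⟩ʳ k))
  act-e k = lookup-ext-permuted (β w) λ j → trans (lookup-act (e k) j) (entry j)
    where
    entry : ∀ j → sgn (r w j) (lookup (e k) j) ≡ lookup (signed (r w k) (e (β w ⟨$⟩ʳ k))) (β w ⟨$⟩ʳ j)
    entry j with j F.≟ k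
    ... | yes refl = begin
      sgn (r w j) (lookup (e j) j)                   ≡⟨ cong (sgn (r w j)) (lookup-e-self j) ⟩
      sgn (r w j) (+ 1)                              ≡⟨ cong (sgn (r w j)) (sym (lookup-e-self (β w ⟨$⟩ʳ j))) ⟩
      sgn (r w j) (lookup (e (β w ⟨$⟩ʳ j)) (β w ⟨$⟩ʳ j)) ≡⟨ sym (lookup-signed (r w j) _ _) ⟩
      lookup (signed (r w j) (e (β w ⟨$⟩ʳ j))) (β w ⟨$⟩ʳ j) ∎
      where open ≡-Reasoning
    ... | no j≢k = trans (cong (sgn (r w j)) (lookup-e-≢ j≢k)) (trans (sgn-zero (r w j))
                         (sym (lookup-signed-e-≢ (r w k) (j≢k ∘ permutation-injective (β w)))))

  act-⊕ : ∀ p j → act w (e p ⊕ e j) ≡ signed (r w p) (e (β w ⟨$⟩ʳ p)) ⊕ signed (r w j) (e (β w ⟨$⟩ʳ j))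
  act-⊕ p j = trans (act-zipWith _+ℤ_ sgn-distrib-+ (e p) (e j)) (cong₂ _⊕_ (act-e p) (act-e j))

  act-⊖ : ∀ p j →
    act w (e p ⊖ e j) ≡ signed (r w p) (e (β w ⟨$⟩ʳ p)) ⊕ signed (opposite (r w j)) (e (β w ⟨$⟩ʳ j))
  act-⊖ p j = begin
    act w (e p ⊖ e j)                      ≡⟨ act-zipWith _-_ sgn-distrib-minus (e p) (e j) ⟩
    act w (e p) ⊖ act w (e j)              ≡⟨ cong₂ _⊖_ (act-e p) (act-e j) ⟩
    signed (r w p) (e (β w ⟨$⟩ʳ p)) ⊖ signed (r w j) (e (β w ⟨$⟩ʳ j)) ≡⟨ ⊖-signed (r w j) _ _ ⟩
    signed (r w p) (e (β w ⟨$⟩ʳ p)) ⊕ signed (opposite (r w j)) (e (β w ⟨$⟩ʳ j)) ∎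
    where open ≡-Reasoning

record TopEntry (c : ℤ) (v : Vecⁿ n) : Set where
  constructor topEntry
  field
    position : Fin n
    at-position : lookup v position ≡ c
    above-position : ∀ m → position F.< m → lookup v m ≡ + 0

topEntry-unique : {v : Vecⁿ n} → TopEntry (+ 1) v → ¬ TopEntry -[1+ 0 ] v
topEntry-unique (topEntry M vM above) (topEntry M′ vM′ above′) with FinP.<-cmp M M′
... | tri< M<M′ _ _ with () ← trans (sym (above M′ M<M′)) vM′
... | tri≈ _ refl _ with () ← trans (sym vM) vM′
... | tri> _ _ M′<M with () ← trans (sym (above′ M M′<M)) vM

topEntry-neg : ∀ {c} {v : Vecⁿ n} → TopEntry c v → TopEntry (- c) (neg v)
topEntry-neg {v = v} (topEntry M vM above) =
  topEntry M (trans (lookup-map M -_ v) (cong -_ vM)) λ m M<m → trans (lookup-map m -_ v) (cong -_ (above m M<m))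

topEntry-e : (a : Fin n) → TopEntry (+ 1) (e a)
topEntry-e a = topEntry a (lookup-e-self a) λ m a<m → lookup-e-≢ (FinP.<⇒≢ a<m ∘ sym)

topEntry-zipWith : ∀ (_∙_ : ℤ → ℤ → ℤ) → (∀ x → x ∙ (+ 0) ≡ x) → ∀ {c} {u v : Vecⁿ n} →
  (top : TopEntry c u) → (∀ m → TopEntry.position top F.≤ m → lookup v m ≡ + 0) → TopEntry c (zipWith _∙_ u v)
topEntry-zipWith _∙_ ∙-identityʳ {c} {u} {v} (topEntry M uM above) v≥M≡0 = topEntry M atM aboveM
  where
  entry : ∀ m → M F.≤ m → lookup (zipWith _∙_ u v) m ≡ lookup u m
  entry m M≤m = trans (lookup-zipWith _∙_ m u v) (trans (cong (lookup u m ∙_) (v≥M≡0 m M≤m)) (∙-identityʳ _))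
  atM : lookup (zipWith _∙_ u v) M ≡ c
  atM = trans (entry M FinP.≤-refl) uM
  aboveM : ∀ m → M F.< m → lookup (zipWith _∙_ u v) m ≡ + 0
  aboveM m M<m = trans (entry m (ℕP.<⇒≤ M<m)) (above m M<m)

lookup-signed-e-below : ∀ s {a b m : Fin n} → b F.< a → a F.≤ m → lookup (signed s (e b)) m ≡ + 0
lookup-signed-e-below s b<a a≤m = lookup-signed-e-≢ s (FinP.<⇒≢ (ℕP.<-≤-trans b<a a≤m) ∘ sym)

topEntry-signed-pair : ∀ s {a b : Fin n} → b F.< a → TopEntry (+ 1) (e a ⊕ signed s (e b))
topEntry-signed-pair s {a} {b} b<a =
  topEntry-zipWith _+ℤ_ ℤP.+-identityʳ (topEntry-e a) (λ m → lookup-signed-e-below s b<a)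

topEntry-⊖ : {a b : Fin n} → b F.< a → TopEntry (+ 1) (e a ⊖ e b)
topEntry-⊖ {a = a} {b} b<a =
  topEntry-zipWith _-_ ℤP.+-identityʳ (topEntry-e a) (λ m → lookup-signed-e-below F.zero b<a)

Ψ⁺-topEntry : All (TopEntry (+ 1)) (Ψ⁺ n)
Ψ⁺-topEntry {n} = ++⁺ (concat⁺ (map⁺ (tabulate⁺ λ l → topEntry-e l ∷ [])))
                      (concat⁺ (map⁺ (tabulate⁺ λ i → concat⁺ (map⁺
                        (All.map (λ i<j → topEntry-⊖ i<j ∷ topEntry-signed-pair F.zero i<j ∷ [])
                                 (all-filter (i F.<?_) (allFin n)))))))

∉Ψ⁻ : {v : Vecⁿ n} → TopEntry (+ 1) v → v ∉ Ψ⁻ n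
∉Ψ⁻ {n} top v∈Ψ⁻ = topEntry-unique top (All.lookup Ψ⁻-topEntry v∈Ψ⁻)
  where
  Ψ⁻-topEntry : All (TopEntry -[1+ 0 ]) (Ψ⁻ n)
  Ψ⁻-topEntry = map⁺ (All.map topEntry-neg Ψ⁺-topEntry)

neg-e∈Ψ⁻ : (a : Fin n) → neg (e a) ∈ Ψ⁻ n
neg-e∈Ψ⁻ a = ∈-map⁺ neg (∈-++⁺ˡ (∈-concatMap⁺ _ (Any.map (λ { refl → here refl }) (∈-allFin a))))

neg-pair∈Ψ⁻ : ∀ {a b : Fin n} {v} → b F.< a → v ∈ e a ⊖ e b ∷ e a ⊕ e b ∷ [] → neg v ∈ Ψ⁻ n
neg-pair∈Ψ⁻ {n} {a} {b} b<a v∈pair = ∈-map⁺ neg (∈-++⁺ʳ _ (∈-concatMap⁺ _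
  (Any.map (λ { refl → ∈-concatMap⁺ _ (Any.map (λ { refl → v∈pair }) (∈-filter⁺ (b F.<?_) (∈-allFin a) b<a)) })
           (∈-allFin b))))

module _ {n : ℕ} where
  open DecMembership (≡-dec {n = n} _≟ℤ_) using (_∈?_)

  indicator-signed-e : ∀ s (a : Fin n) → indicator (signed s (e a) ∈? Ψ⁻ n) ≡ toℕ s
  indicator-signed-e F.zero         a = indicator-no (_ ∈? Ψ⁻ n) (∉Ψ⁻ (topEntry-e a))
  indicator-signed-e (F.suc F.zero) a = indicator-yes (_ ∈? Ψ⁻ n) (neg-e∈Ψ⁻ a)

  indicator-signed-pair : ∀ s t {a b : Fin n} → b F.< a →
    indicator (signed s (e a) ⊕ signed t (e b) ∈? Ψ⁻ n) ≡ toℕ s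
  indicator-signed-pair F.zero t b<a = indicator-no (_ ∈? Ψ⁻ n) (∉Ψ⁻ (topEntry-signed-pair t b<a))
  indicator-signed-pair (F.suc F.zero) F.zero {a} {b} b<a =
    indicator-yes (_ ∈? Ψ⁻ n) (subst (_∈ Ψ⁻ n) (neg-⊖ (e a) (e b)) (neg-pair∈Ψ⁻ b<a (here refl)))
  indicator-signed-pair (F.suc F.zero) (F.suc F.zero) {a} {b} b<a =
    indicator-yes (_ ∈? Ψ⁻ n) (subst (_∈ Ψ⁻ n) (neg-⊕ (e a) (e b)) (neg-pair∈Ψ⁻ b<a (there (here refl))))

  module _ (w : Bn n) (p : Fin n) where

    sentToΨ⁻? : Decidable (λ v → act w v ∈ Ψ⁻ n)
    sentToΨ⁻? v = act w v ∈? Ψ⁻ n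

    βless? : Decidable (λ j → β w ⟨$⟩ʳ j F.< β w ⟨$⟩ʳ p)
    βless? j = (β w ⟨$⟩ʳ j) F.<? (β w ⟨$⟩ʳ p)

    βgreater? : Decidable (λ j → β w ⟨$⟩ʳ p F.< β w ⟨$⟩ʳ j)
    βgreater? j = (β w ⟨$⟩ʳ p) F.<? (β w ⟨$⟩ʳ j)

    pairsAt : Fin n → List (Vecⁿ n)
    pairsAt j = e p ⊖ e j ∷ e p ⊕ e j ∷ []

    pairIndicator : Fin n → ℕ
    pairIndicator j = indicator (sentToΨ⁻? (e p ⊖ e j)) + indicator (sentToΨ⁻? (e p ⊕ e j))

    indicator-act-e : indicator (sentToΨ⁻? (e p)) ≡ toℕ (r w p)
    indicator-act-e = trans (cong (λ v → indicator (v ∈? Ψ⁻ n)) (act-e w p)) (indicator-signed-e (r w p) _)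

    pairIndicator-below : ∀ {j} → β w ⟨$⟩ʳ j F.< β w ⟨$⟩ʳ p → pairIndicator j ≡ toℕ (r w p) + toℕ (r w p)
    pairIndicator-below {j} βj<βp = cong₂ _+_
      (trans (cong (λ v → indicator (v ∈? Ψ⁻ n)) (act-⊖ w p j))
             (indicator-signed-pair (r w p) (opposite (r w j)) βj<βp))
      (trans (cong (λ v → indicator (v ∈? Ψ⁻ n)) (act-⊕ w p j))
             (indicator-signed-pair (r w p) (r w j) βj<βp))

    pairIndicator-above : ∀ {j} → β w ⟨$⟩ʳ p F.< β w ⟨$⟩ʳ j → pairIndicator j ≡ 1
    pairIndicator-above {j} βp<βj = trans (cong₂ _+_
      (trans (cong (λ v → indicator (v ∈? Ψ⁻ n)) (trans (act-⊖ w p j) (⊕-comm _ _)))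
             (indicator-signed-pair (opposite (r w j)) (r w p) βp<βj))
      (trans (cong (λ v → indicator (v ∈? Ψ⁻ n)) (trans (act-⊕ w p j) (⊕-comm _ _)))
             (indicator-signed-pair (r w j) (r w p) βp<βj)))
      (opposite+id≡1 (r w j))
      where
      opposite+id≡1 : ∀ s → toℕ (opposite s) + toℕ s ≡ 1
      opposite+id≡1 F.zero         = refl
      opposite+id≡1 (F.suc F.zero) = refl

    length-filter-pairsAt-∷ : ∀ j js →
      length (filter sentToΨ⁻? (concatMap pairsAt (j ∷ js)))
        ≡ pairIndicator j + length (filter sentToΨ⁻? (concatMap pairsAt js))
    length-filter-pairsAt-∷ j js = begin
      length (filter sentToΨ⁻? (e p ⊖ e j ∷ e p ⊕ e j ∷ rest))
        ≡⟨ length-filter-∷ sentToΨ⁻? _ _ ⟩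
      indicator (sentToΨ⁻? (e p ⊖ e j)) + length (filter sentToΨ⁻? (e p ⊕ e j ∷ rest))
        ≡⟨ cong₂ _+_ refl (length-filter-∷ sentToΨ⁻? _ _) ⟩
      indicator (sentToΨ⁻? (e p ⊖ e j)) + (indicator (sentToΨ⁻? (e p ⊕ e j)) + length (filter sentToΨ⁻? rest))
        ≡⟨ sym (ℕP.+-assoc (indicator (sentToΨ⁻? (e p ⊖ e j))) _ _) ⟩
      pairIndicator j + length (filter sentToΨ⁻? rest) ∎
      where
      open ≡-Reasoning
      rest : List (Vecⁿ n)
      rest = concatMap pairsAt js

    length-filter-pairs : ∀ js → All (_≢ p) js →
      length (filter sentToΨ⁻? (concatMap pairsAt js))
        ≡ 2 * (toℕ (r w p) * length (filter βless? js)) + length (filter βgreater? js)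
    length-filter-pairs []       []           = cong (λ m → 2 * m + 0) (sym (ℕP.*-zeroʳ (toℕ (r w p))))
    length-filter-pairs (j ∷ js) (j≢p ∷ js≢p) with FinP.<-cmp (β w ⟨$⟩ʳ j) (β w ⟨$⟩ʳ p)
    ... | tri< βj<βp _ βp≮βj
      rewrite length-filter-pairsAt-∷ j js | pairIndicator-below βj<βp | length-filter-pairs js js≢p
            | filter-accept βless? {xs = js} βj<βp | filter-reject βgreater? {xs = js} βp≮βj
      = below-step (toℕ (r w p)) _ _
      where
      below-step : ∀ x L G → (x + x) + (2 * (x * L) + G) ≡ 2 * (x * suc L) + G
      below-step = solve-∀
    ... | tri≈ _ βj≡βp _ with () ← j≢p (permutation-injective (β w) βj≡βp)
    ... | tri> βj≮βp _ βp<βj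
      rewrite length-filter-pairsAt-∷ j js | pairIndicator-above βp<βj | length-filter-pairs js js≢p
            | filter-reject βless? {xs = js} βj≮βp | filter-accept βgreater? {xs = js} βp<βj
      = sym (ℕP.+-suc _ _)

    countLessNonzero≡ : countLessNonzero w p ≡ toℕ (r w p) * countLess (β w) p
    countLessNonzero≡ = begin
      length (filter (F._<? p) (filter βless? (filter nonzero? (allFin n))))
        ≡⟨ cong (length ∘ filter (F._<? p)) (filter-comm βless? nonzero? (allFin n)) ⟩
      length (filter (F._<? p) (filter nonzero? (filter βless? (allFin n))))
        ≡⟨ cong length (filter-comm (F._<? p) nonzero? (filter βless? (allFin n))) ⟩
      length (filter nonzero? (filter (F._<? p) (filter βless? (allFin n))))
        ≡⟨ length-filter-nonzero (r w p) (filter (F._<? p) (filter βless? (allFin n))) ⟩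
      toℕ (r w p) * countLess (β w) p ∎
      where
      open ≡-Reasoning
      nonzero? : Decidable {A = Fin n} (λ _ → r w p ≢ F.zero)
      nonzero? _ = ¬? (r w p F.≟ F.zero)

inv-formula : ∀ (w : Bn n) i → let p = opposite i in
  inv w i ≡ toℕ (r w p) + 2 * (toℕ (r w p) * countLess (β w) p) + invPerm (β w) i
inv-formula {n} w i = begin
  inv w i
    ≡⟨ length-filter-∷ (sentToΨ⁻? w p) (e p) (concatMap (pairsAt w p) below-p) ⟩
  indicator (sentToΨ⁻? w p (e p)) + length (filter (sentToΨ⁻? w p) (concatMap (pairsAt w p) below-p))
    ≡⟨ cong₂ _+_ (indicator-act-e w p) (length-filter-pairs w p below-p below-p≢p) ⟩
  toℕ (r w p) + (2 * (toℕ (r w p) * length (filter (βless? w p) below-p)) + length (filter (βgreater? w p) below-p))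
    ≡⟨ cong₂ (λ L G → toℕ (r w p) + (2 * (toℕ (r w p) * L) + G))
             (cong length (sym (filter-comm (F._<? p) (βless? w p) (allFin n))))
             (cong length (sym (filter-comm (F._<? p) (βgreater? w p) (allFin n)))) ⟩
  toℕ (r w p) + (2 * (toℕ (r w p) * countLess (β w) p) + invPerm (β w) i)
    ≡⟨ sym (ℕP.+-assoc (toℕ (r w p)) _ _) ⟩
  toℕ (r w p) + 2 * (toℕ (r w p) * countLess (β w) p) + invPerm (β w) i ∎
  where
  open ≡-Reasoning
  p : Fin n
  p = opposite i
  below-p : List (Fin n)
  below-p = filter (F._<? p) (allFin n)
  below-p≢p : All (_≢ p) below-p
  below-p≢p = All.map FinP.<⇒≢ (all-filter (F._<? p) (allFin n))

mainTheorem1 : (n : ℕ) → (w : Bn n) → (i : Fin n) →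
    (inv w i ≡ toℕ (r w (opposite i)) + 2 * countLessNonzero w (opposite i) + invPerm (β w) i)
    × (r w (opposite i) ≡ F.suc F.zero → inv w i ≡ 1 + 2 * countLess (β w) (opposite i) + invPerm (β w) i)
    × (r w (opposite i) ≡ F.zero → inv w i ≡ invPerm (β w) i)
mainTheorem1 n w i =
    trans (inv-formula w i)
          (cong (λ c → toℕ (r w p) + 2 * c + invPerm (β w) i) (sym (countLessNonzero≡ w p)))
  , (λ r≡1 → trans (formulaAt r≡1)
                   (cong (λ c → 1 + 2 * c + invPerm (β w) i) (ℕP.*-identityˡ (countLess (β w) p))))
  , formulaAt
  where
  p : Fin n
  p = opposite i
  formulaAt : ∀ {s} → r w p ≡ s → inv w i ≡ toℕ s + 2 * (toℕ s * countLess (β w) p) + invPerm (β w) i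
  formulaAt refl = inv-formula w i
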